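{- In a tredoku tiling, every $2$-tile lies in two distinct runs and is an end tile of each of them.
   Context: A tile is a closed rhombus of unit side with interior angles $60^\circ$ and $120^\circ$, placed so that its edges lie on a fixed triangular lattice of the plane. Two tiles are adjacent if they share a full common edge. A run is a maximal sequence $T_1,\dots,T_k$ ($k\ge 2$) of distinct tiles such that $T_i$ and $T_{i+1}$ share an edge $e_i$, all the $e_i$ are parallel, and for $1<i<k$ the edges $e_{i-1},e_i$ are opposite edges of $T_i$; $T_1$ and $T_k$ are its end tiles. A tredoku tiling is a finite set of $\tau\ge5$ tiles such that: (P1) the adjacency graph on the tiles is connected; (P2) any two tiles are disjoint, meet in exactly one common vertex, or share a full common edge; (P3) after removing any single tile, the remaining tiles are still connected, where two tiles are considered joined if they have nonempty intersection; (P4/P5) every run consists of exactly three tiles; and (no holes) the complement of the union of the tiles is connected. An $i$-tile is a tile adjacent to exactly $i$ other tiles. -}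

module Defs where

open import Data.Nat using (ℕ; suc; _≤_)
open import Data.Integer using (ℤ; 0ℤ; 1ℤ; -1ℤ) renaming (_+_ to _+ℤ_)
open import Data.Product using (Σ; _×_; _,_; proj₁; proj₂)
open import Data.Sum using (_⊎_)
open import Data.Fin using (Fin; zero; suc; inject₁)
open import Data.List using (List; []; _∷_; _++_; map; length)
open import Data.List.Membership.Propositional using (_∈_)
open import Data.List.Relation.Unary.Unique.Propositional using (Unique)
open import Data.Vec using (Vec; lookup; head; last; _∷ʳ_) renaming (_∷_ to _∷ᵥ_)
open import Data.Vec.Membership.Propositional renaming (_∈_ to _∈ᵥ_)
open import Relation.Binary.PropositionalEquality using (_≡_; _≢_)
open import Relation.Nullary using (¬_)

-- The triangular lattice.
-- Lattice points are a·1 + b·ω (ω = e^{iπ/3}), encoded as (a , b) ∈ ℤ².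
-- The three edge directions are d0 = 1, d1 = ω, d2 = ω² = ω - 1.

Point : Set
Point = ℤ × ℤ

_⊕_ : Point → Point → Point
(a , b) ⊕ (c , d) = (a +ℤ c , b +ℤ d)

data Dir : Set where
  D0 D1 D2 : Dir

dv : Dir → Point
dv D0 = (1ℤ , 0ℤ)
dv D1 = (0ℤ , 1ℤ)
dv D2 = (-1ℤ , 1ℤ)

-- Every unit lattice segment has exactly one such representation, and two
-- edges are parallel iff they have the same direction component.
Edge : Set
Edge = Point × Dir

src tgt : Edge → Point
src (p , d) = p
tgt (p , d) = p ⊕ dv d

-- Lattice triangles: up p = [p, p+d0, p+d1], down p = [p+d0, p+d1, p+d0+d1].
data Orient : Set where
  up down : Orient

Triangle : Set
Triangle = Point × Orient

triSides : Triangle → List Edge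
triSides (p , up)   = (p , D0) ∷ (p , D1) ∷ (p ⊕ dv D0 , D2) ∷ []
triSides (p , down) = (p ⊕ dv D1 , D0) ∷ (p ⊕ dv D0 , D1) ∷ (p ⊕ dv D0 , D2) ∷ []

-- Every point of the plane
-- lies in the relative interior of exactly one face, so a closed union of
-- lattice cells is faithfully described by the set of faces it contains.
data Face : Set where
  vert : Point → Face
  edg  : Edge → Face
  tri  : Triangle → Face

-- Tiles.  (k , p) is the closed rhombus with vertex p spanned by the two
-- directions different from k.  Every 60/120 unit rhombus with edges on the
-- lattice has exactly one such representation.

Tile : Set
Tile = Dir × Point

spanDirs : Dir → Dir × Dir
spanDirs D0 = (D1 , D2)
spanDirs D1 = (D0 , D2)
spanDirs D2 = (D0 , D1)

sides : Tile → List Edge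
sides (k , p) with spanDirs k
... | (i , j) = (p , i) ∷ (p , j) ∷ (p ⊕ dv j , i) ∷ (p ⊕ dv i , j) ∷ []

oppPairs : Tile → List (Edge × Edge)
oppPairs (k , p) with spanDirs k
... | (i , j) = ((p , i) , (p ⊕ dv j , i)) ∷ ((p ⊕ dv j , i) , (p , i))
              ∷ ((p , j) , (p ⊕ dv i , j)) ∷ ((p ⊕ dv i , j) , (p , j)) ∷ []

vertices : Tile → List Point
vertices (k , p) with spanDirs k
... | (i , j) = p ∷ (p ⊕ dv i) ∷ (p ⊕ dv j) ∷ ((p ⊕ dv i) ⊕ dv j) ∷ []

-- the short diagonal (interior lattice edge) of a tile
diagonal : Tile → Edge
diagonal (D0 , p) = (p ⊕ dv D2 , D0)
diagonal (D1 , p) = (p , D1)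
diagonal (D2 , p) = (p ⊕ dv D0 , D2)

triangles : Tile → List Triangle
triangles (D0 , p) = (p ⊕ (-1ℤ , 0ℤ) , down) ∷ (p ⊕ dv D2 , up) ∷ []
triangles (D1 , p) = (p , up) ∷ (p ⊕ (-1ℤ , 0ℤ) , down) ∷ []
triangles (D2 , p) = (p , up) ∷ (p , down) ∷ []

faces : Tile → List Face
faces t = map vert (vertices t) ++ map edg (diagonal t ∷ sides t) ++ map tri (triangles t)

Side : Tile → Edge → Set
Side t e = e ∈ sides t

Opposite : Tile → Edge → Edge → Set
Opposite t e e' = (e , e') ∈ oppPairs t

Common : Tile → Tile → Face → Set
Common s t f = f ∈ faces s × f ∈ faces t

Meets : Tile → Tile → Set
Meets s t = Σ Face (Common s t)

Adjacent : Tile → Tile → Set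
Adjacent s t = Σ Edge λ e → Side s e × Side t e

GoodMeet : Tile → Tile → Set
GoodMeet s t =
    (∀ f → ¬ Common s t f)
  ⊎ (Σ Point λ v → ∀ f → (Common s t f → f ≡ vert v) × (f ≡ vert v → Common s t f))
  ⊎ (Σ Edge λ e → Side s e × Side t e ×
       (∀ f → Common s t f → f ≡ edg e ⊎ f ≡ vert (src e) ⊎ f ≡ vert (tgt e)))

data Path {A : Set} (P : A → Set) (R : A → A → Set) : A → A → Set where
  stop : ∀ {a} → P a → Path P R a a
  step : ∀ {a b c} → P a → R a b → Path P R b c → Path P R a c

Connected : {A : Set} → (A → Set) → (A → A → Set) → Set
Connected {A} P R = ∀ {s t : A} → P s → P t → Path P R s t

-- Runs.  A chain T₁,…,T_k (k = m+2) with shared edges e₁,…,e_{k-1}.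

record ChainWith (T : List Tile) {m : ℕ} (ts : Vec Tile (suc (suc m)))
                 (es : Vec Edge (suc m)) : Set where
  field
    inT      : ∀ i → lookup ts i ∈ T
    distinct : ∀ i j → lookup ts i ≡ lookup ts j → i ≡ j
    shared   : ∀ (i : Fin (suc m)) →
               Side (lookup ts (inject₁ i)) (lookup es i) × Side (lookup ts (suc i)) (lookup es i)
    parallel : ∀ (i : Fin (suc m)) → proj₂ (lookup es i) ≡ proj₂ (lookup es zero)
    opposite : ∀ (j : Fin m) →
               Opposite (lookup ts (suc (inject₁ j))) (lookup es (inject₁ j)) (lookup es (suc j))

IsChain : List Tile → {m : ℕ} → Vec Tile (suc (suc m)) → Set
IsChain T {m} ts = Σ (Vec Edge (suc m)) (ChainWith T ts)

Maximal : List Tile → {m : ℕ} → Vec Tile (suc (suc m)) → Set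
Maximal T ts = (∀ t → ¬ IsChain T (t ∷ᵥ ts)) × (∀ t → ¬ IsChain T (ts ∷ʳ t))

IsRun : List Tile → {m : ℕ} → Vec Tile (suc (suc m)) → Set
IsRun T ts = IsChain T ts × Maximal T ts

EndTile : Tile → {m : ℕ} → Vec Tile (suc (suc m)) → Set
EndTile t ts = head ts ≡ t ⊎ last ts ≡ t

DistinctRuns : {m n : ℕ} → Vec Tile (suc (suc m)) → Vec Tile (suc (suc n)) → Set
DistinctRuns r₁ r₂ = Σ Tile λ u → (u ∈ᵥ r₁ × ¬ u ∈ᵥ r₂) ⊎ (u ∈ᵥ r₂ × ¬ u ∈ᵥ r₁)

Covered : List Tile → Face → Set
Covered T f = Σ Tile λ t → t ∈ T × f ∈ faces t

ComplAdj : List Tile → Triangle → Triangle → Set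
ComplAdj T Δ Δ' = Δ ≢ Δ' × Σ Edge λ e → e ∈ triSides Δ × e ∈ triSides Δ' × ¬ Covered T (edg e)

record Tredoku (T : List Tile) : Set where
  field
    noDup   : Unique T
    size    : 5 ≤ length T
    P1      : Connected (_∈ T) Adjacent
    P2      : ∀ {s t} → s ∈ T → t ∈ T → s ≢ t → GoodMeet s t
    P3      : ∀ {r} → r ∈ T → Connected (λ t → t ∈ T × t ≢ r) Meets
    P45     : ∀ {m} (ts : Vec Tile (suc (suc m))) → IsRun T ts → m ≡ 1
    noHoles : Connected (λ Δ → ¬ Covered T (tri Δ)) (ComplAdj T)

TwoTile : List Tile → Tile → Set
TwoTile T t = Σ Tile λ u → Σ Tile λ v →
  u ≢ v × u ∈ T × v ∈ T × u ≢ t × v ≢ t × Adjacent t u × Adjacent t v ×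
  (∀ w → w ∈ T → w ≢ t → Adjacent t w → w ≡ u ⊎ w ≡ v)

{-# OPTIONS --safe #-}
module Submission where

-- Let the 2-tile t meet its neighbours u and v along the sides eu and ev.
--
-- First, eu and ev are not parallel. If eu = ev, three tiles contain a common
-- edge, so two of them contain the same lattice triangle, contradicting (P2).
-- If eu and ev are opposite sides of t, then by (P3) u and v are connected
-- without t, so there is a lattice walk from u to v along sides of tiles
-- other than t. Count, mod 2, how often the
-- walk crosses a horizontal ray. This count differs between the two triangles
-- just outside f₁ and f₂. But both triangles are uncovered, so since there are
-- no holes they are joined by a path of uncovered triangles, and that path
-- never crosses the walk.
--
-- So the chain u, t can be extended at the front to a maximal chain. Nothing
-- can follow t: the next tile would have to be v, across a side parallel to
-- eu. The maximal chain is therefore a run, and by (P4/P5) it is w₁, u, t.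
-- Likewise w₂, v, t is a run. The two runs are distinct, since otherwise u
-- and v would share one side parallel to eu and another parallel to ev.

open import Defs
open import Algebra.Bundles using (AbelianGroup; CommutativeRing)
open import Data.Bool using (Bool; true; false; _∧_; _xor_)
import Data.Bool.Properties as Bool
open import Data.Empty using (⊥; ⊥-elim)
open import Data.Fin using (zero; suc)
open import Data.Fin.Properties using (0≢1+n; suc-injective; injective⇒≤)
open import Data.Integer using (0ℤ; 1ℤ; -1ℤ) renaming (_+_ to _+ℤ_; _≤_ to _≤ℤ_)
import Data.Integer.Properties as ℤ
import Data.List as List
open import Data.List using (List; []; _∷_; _++_; map; length)
open import Data.List.Membership.Propositional using (_∈_; find; lose)
open import Data.List.Membership.Propositional.Properties using (∈-map⁺; ∈-map⁻; ∈-++⁺ˡ; ∈-++⁺ʳ; ∈-++⁻)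
open import Data.List.Relation.Unary.All as All using (All; []; _∷_)
open import Data.List.Relation.Unary.All.Properties using (++⁺)
open import Data.List.Relation.Unary.Any as Any using (any?; here; there)
open import Data.List.Relation.Unary.Any.Properties using (lookup-index)
open import Data.Nat using (ℕ; zero; suc; _≤_; _+_)
open import Data.Nat.Properties using (<⇒≱; +-suc; m≤m+n)
open import Data.Product using (Σ; _×_; _,_; proj₁; proj₂)
open import Data.Sum using (_⊎_; inj₁; inj₂; [_,_]′)
open import Data.Vec using (Vec; lookup; _∷ʳ_) renaming ([] to []ᵥ; _∷_ to _∷ᵥ_)
import Data.Vec.Relation.Unary.Any as VecAny
open import Data.Vec.Relation.Unary.Any.Properties using () renaming (lookup-index to vec-lookup-index)
open import Data.Vec.Membership.Propositional using () renaming (_∈_ to _∈ᵥ_)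
open import Data.Vec.Membership.Propositional.Properties using (∈-lookup)
open import Function using (_∘_; id)
open import Function.Bundles using (mk⇔)
open import Relation.Binary.Definitions using (DecidableEquality)
open import Relation.Binary.PropositionalEquality
open import Relation.Nullary using (¬_; Dec; yes; no; does; ¬?; contradiction)
open import Relation.Nullary.Decidable using (_×-dec_; map′; does-⇔; dec-true; dec-false)
open import Relation.Unary using (_⊆_)

open import Algebra.Properties.Group (AbelianGroup.group ℤ.+-0-abelianGroup)
  using (∙-cancelʳ; ∙-cancelˡ)
open import Algebra.Properties.CommutativeSemigroup
  (CommutativeRing.+-commutativeSemigroup Bool.xor-∧-commutativeRing)
  using () renaming (interchange to xor-interchange)

pattern at₀ = here refl
pattern at₁ = there (here refl)
pattern at₂ = there (there (here refl))
pattern at₃ = there (there (there (here refl)))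

_≟ᵈ_ : DecidableEquality Dir
D0 ≟ᵈ D0 = yes refl
D1 ≟ᵈ D1 = yes refl
D2 ≟ᵈ D2 = yes refl
D0 ≟ᵈ D1 = no λ ()
D0 ≟ᵈ D2 = no λ ()
D1 ≟ᵈ D0 = no λ ()
D1 ≟ᵈ D2 = no λ ()
D2 ≟ᵈ D0 = no λ ()
D2 ≟ᵈ D1 = no λ ()

-- Unlike Data.Product.Properties.≡-dec, this one makes `does` compute to the
-- conjunction of the componentwise tests.
pair-≡-dec : ∀ {A B : Set} → DecidableEquality A → DecidableEquality B → DecidableEquality (A × B)
pair-≡-dec _≟₁_ _≟₂_ (a , b) (a' , b') =
  map′ (λ (p , q) → cong₂ _,_ p q) (λ eq → cong proj₁ eq , cong proj₂ eq) (a ≟₁ a' ×-dec b ≟₂ b')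

_≟ᵖ_ : DecidableEquality Point
_≟ᵖ_ = pair-≡-dec ℤ._≟_ ℤ._≟_

-- Comparing directions first means edges of different directions already
-- evaluate to distinct.
_≟ᵉ_ : DecidableEquality Edge
(p , d) ≟ᵉ (q , d') =
  map′ (λ (d≡d' , p≡q) → cong₂ _,_ p≡q d≡d') (λ eq → cong proj₂ eq , cong proj₁ eq) (d ≟ᵈ d' ×-dec p ≟ᵖ q)

_≟ᵗ_ : DecidableEquality Tile
_≟ᵗ_ = pair-≡-dec _≟ᵈ_ _≟ᵖ_

open import Data.List.Membership.DecPropositional (pair-≡-dec _≟ᵉ_ _≟ᵉ_) using () renaming (_∈?_ to _∈ᵉᵉ?_)
open import Data.Vec.Membership.DecPropositional _≟ᵗ_ using () renaming (_∈?_ to _∈ᵥ?_)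

⊕-assoc : ∀ p q r → (p ⊕ q) ⊕ r ≡ p ⊕ (q ⊕ r)
⊕-assoc (a , b) (c , d) (e , f) = cong₂ _,_ (ℤ.+-assoc a c e) (ℤ.+-assoc b d f)

⊕-identityʳ : ∀ p → p ⊕ (0ℤ , 0ℤ) ≡ p
⊕-identityʳ (a , b) = cong₂ _,_ (ℤ.+-identityʳ a) (ℤ.+-identityʳ b)

⊕-cancelˡ : ∀ p q r → p ⊕ q ≡ p ⊕ r → q ≡ r
⊕-cancelˡ (a , b) (c , d) (e , f) eq =
  cong₂ _,_ (∙-cancelˡ a c e (cong proj₁ eq)) (∙-cancelˡ b d f (cong proj₂ eq))

⊕-cancelʳ : ∀ p q r → q ⊕ p ≡ r ⊕ p → q ≡ r
⊕-cancelʳ (a , b) (c , d) (e , f) eq =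
  cong₂ _,_ (∙-cancelʳ a c e (cong proj₁ eq)) (∙-cancelʳ b d f (cong proj₂ eq))

⊕-≢ : ∀ p c c' → c ≢ c' → p ⊕ c ≢ p ⊕ c'
⊕-≢ p c c' c≢c' eq = c≢c' (⊕-cancelˡ p c c' eq)

⊕-≢-self : ∀ p c → c ≢ (0ℤ , 0ℤ) → p ⊕ c ≢ p
⊕-≢-self p c c≢0 eq = c≢0 (⊕-cancelˡ p c (0ℤ , 0ℤ) (trans eq (sym (⊕-identityʳ p))))

⊕-back-D0 : ∀ p → (p ⊕ (-1ℤ , 0ℤ)) ⊕ dv D0 ≡ p
⊕-back-D0 p = trans (⊕-assoc p (-1ℤ , 0ℤ) (dv D0)) (⊕-identityʳ p)

⊕-back-D1 : ∀ p → (p ⊕ (0ℤ , -1ℤ)) ⊕ dv D1 ≡ p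
⊕-back-D1 p = trans (⊕-assoc p (0ℤ , -1ℤ) (dv D1)) (⊕-identityʳ p)

≟-sym : ∀ a b → does (a ℤ.≟ b) ≡ does (b ℤ.≟ a)
≟-sym a b = does-⇔ (mk⇔ sym sym) (a ℤ.≟ b) (b ℤ.≟ a)

≟-+-cancelʳ : ∀ a b k → does (a +ℤ k ℤ.≟ b +ℤ k) ≡ does (a ℤ.≟ b)
≟-+-cancelʳ a b k = does-⇔ (mk⇔ (∙-cancelʳ k a b) (cong (_+ℤ k))) (a +ℤ k ℤ.≟ b +ℤ k) (a ℤ.≟ b)

≤-xor-≤1+ : ∀ c a → does (c ℤ.≤? a) xor does (c ℤ.≤? a +ℤ 1ℤ) ≡ does (c ℤ.≟ a +ℤ 1ℤ)
≤-xor-≤1+ c a rewrite ℤ.+-comm a 1ℤ with c ℤ.≤? a | c ℤ.≤? 1ℤ +ℤ a | c ℤ.≟ 1ℤ +ℤ a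
... | yes c≤a | _         | yes refl = ⊥-elim (ℤ.<-irrefl refl (ℤ.suc[i]≤j⇒i<j c≤a))
... | yes _   | yes _     | no _     = refl
... | yes c≤a | no c≰1+a  | _        = ⊥-elim (c≰1+a (ℤ.i≤j⇒i≤1+j c≤a))
... | no _    | yes _     | yes _    = refl
... | no c≰a  | yes c≤1+a | no c≢1+a = ⊥-elim (c≢1+a (ℤ.≤-antisym c≤1+a (ℤ.i<j⇒suc[i]≤j (ℤ.≰⇒> c≰a))))
... | no _    | no c≰1+a  | yes refl = ⊥-elim (c≰1+a ℤ.≤-refl)
... | no _    | no _      | no _     = refl

≤-xor-1+≤ : ∀ c a → does (c ℤ.≤? a) xor does (c +ℤ 1ℤ ℤ.≤? a) ≡ does (a ℤ.≟ c)
≤-xor-1+≤ c a rewrite ℤ.+-comm c 1ℤ with c ℤ.≤? a | 1ℤ +ℤ c ℤ.≤? a | a ℤ.≟ c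
... | _       | yes 1+c≤a | yes refl = ⊥-elim (ℤ.<-irrefl refl (ℤ.suc[i]≤j⇒i<j 1+c≤a))
... | yes _   | yes _     | no _     = refl
... | yes _   | no _      | yes _    = refl
... | yes c≤a | no 1+c≰a  | no a≢c   = ⊥-elim (1+c≰a (ℤ.i<j⇒suc[i]≤j (ℤ.≤∧≢⇒< c≤a (a≢c ∘ sym))))
... | no c≰a  | yes 1+c≤a | _        = ⊥-elim (c≰a (ℤ.<⇒≤ (ℤ.suc[i]≤j⇒i<j 1+c≤a)))
... | no c≰a  | no _      | yes refl = ⊥-elim (c≰a ℤ.≤-refl)
... | no _    | no _      | no _     = refl

-1+≤-≡-≤1+ : ∀ c a → does (c +ℤ -1ℤ ℤ.≤? a) ≡ does (c ℤ.≤? a +ℤ 1ℤ)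
-1+≤-≡-≤1+ c a = does-⇔ (mk⇔ to from) (c +ℤ -1ℤ ℤ.≤? a) (c ℤ.≤? a +ℤ 1ℤ)
  where
  to : c +ℤ -1ℤ ≤ℤ a → c ≤ℤ a +ℤ 1ℤ
  to h = subst (_≤ℤ a +ℤ 1ℤ) (trans (ℤ.+-assoc c -1ℤ 1ℤ) (ℤ.+-identityʳ c)) (ℤ.+-monoˡ-≤ 1ℤ h)
  from : c ≤ℤ a +ℤ 1ℤ → c +ℤ -1ℤ ≤ℤ a
  from h = subst (c +ℤ -1ℤ ≤ℤ_) (trans (ℤ.+-assoc a 1ℤ -1ℤ) (ℤ.+-identityʳ a)) (ℤ.+-monoˡ-≤ -1ℤ h)

∧-xor-∧ : ∀ b x y → (b ∧ x) xor (b ∧ y) ≡ ((x xor y) ∧ b) xor false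
∧-xor-∧ b x y = begin
  (b ∧ x) xor (b ∧ y)      ≡⟨ Bool.∧-distribˡ-xor b x y ⟨
  b ∧ (x xor y)            ≡⟨ Bool.∧-comm b (x xor y) ⟩
  (x xor y) ∧ b            ≡⟨ Bool.xor-identityʳ ((x xor y) ∧ b) ⟨
  ((x xor y) ∧ b) xor false ∎
  where open ≡-Reasoning

xor-telescope : ∀ a b c → (a xor b) xor (b xor c) ≡ a xor c
xor-telescope a b c = begin
  (a xor b) xor (b xor c)  ≡⟨ Bool.xor-assoc a b (b xor c) ⟩
  a xor (b xor (b xor c))  ≡⟨ cong (a xor_) (sym (Bool.xor-assoc b b c)) ⟩
  a xor ((b xor b) xor c)  ≡⟨ cong (λ z → a xor (z xor c)) (Bool.xor-same b) ⟩
  a xor c                  ∎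
  where open ≡-Reasoning

xor-≡-false⇒≡ : ∀ a b → a xor b ≡ false → a ≡ b
xor-≡-false⇒≡ true  true  _ = refl
xor-≡-false⇒≡ false false _ = refl
xor-≡-false⇒≡ true  false ()
xor-≡-false⇒≡ false true  ()

sideOf : Triangle → Dir → Edge
sideOf (p , up)   D0 = (p , D0)
sideOf (p , up)   D1 = (p , D1)
sideOf (p , up)   D2 = (p ⊕ dv D0 , D2)
sideOf (p , down) D0 = (p ⊕ dv D1 , D0)
sideOf (p , down) D1 = (p ⊕ dv D0 , D1)
sideOf (p , down) D2 = (p ⊕ dv D0 , D2)

triSides-sideOf : ∀ Δ {e} → e ∈ triSides Δ → e ≡ sideOf Δ (proj₂ e)
triSides-sideOf (p , up)   at₀ = refl
triSides-sideOf (p , up)   at₁ = refl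
triSides-sideOf (p , up)   at₂ = refl
triSides-sideOf (p , down) at₀ = refl
triSides-sideOf (p , down) at₁ = refl
triSides-sideOf (p , down) at₂ = refl

sideOf-injective : ∀ {p q} o d → sideOf (p , o) d ≡ sideOf (q , o) d → p ≡ q
sideOf-injective up   D0 eq = cong proj₁ eq
sideOf-injective up   D1 eq = cong proj₁ eq
sideOf-injective up   D2 eq = ⊕-cancelʳ (dv D0) _ _ (cong proj₁ eq)
sideOf-injective down D0 eq = ⊕-cancelʳ (dv D1) _ _ (cong proj₁ eq)
sideOf-injective down D1 eq = ⊕-cancelʳ (dv D0) _ _ (cong proj₁ eq)
sideOf-injective down D2 eq = ⊕-cancelʳ (dv D0) _ _ (cong proj₁ eq)

same-orientation-common-side : ∀ {p q o e} → e ∈ triSides (p , o) → e ∈ triSides (q , o) → (p , o) ≡ (q , o)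
same-orientation-common-side {p} {q} {o} {e} i i' =
  cong (_, o) (sideOf-injective o (proj₂ e) (trans (sym (triSides-sideOf (p , o) i)) (triSides-sideOf (q , o) i')))

no-three-triangles-share-side : ∀ {Δ₁ Δ₂ Δ₃ e} → e ∈ triSides Δ₁ → e ∈ triSides Δ₂ → e ∈ triSides Δ₃ →
                                Δ₁ ≡ Δ₂ ⊎ Δ₁ ≡ Δ₃ ⊎ Δ₂ ≡ Δ₃
no-three-triangles-share-side {_ , up}   {_ , up}   i₁ i₂ i₃ = inj₁ (same-orientation-common-side i₁ i₂)
no-three-triangles-share-side {_ , down} {_ , down} i₁ i₂ i₃ = inj₁ (same-orientation-common-side i₁ i₂)
no-three-triangles-share-side {_ , up}   {_ , down} {_ , up}   i₁ i₂ i₃ =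
  inj₂ (inj₁ (same-orientation-common-side i₁ i₃))
no-three-triangles-share-side {_ , down} {_ , up}   {_ , down} i₁ i₂ i₃ =
  inj₂ (inj₁ (same-orientation-common-side i₁ i₃))
no-three-triangles-share-side {_ , up}   {_ , down} {_ , down} i₁ i₂ i₃ =
  inj₂ (inj₂ (same-orientation-common-side i₂ i₃))
no-three-triangles-share-side {_ , down} {_ , up}   {_ , up}   i₁ i₂ i₃ =
  inj₂ (inj₂ (same-orientation-common-side i₂ i₃))

data Across : Triangle → Triangle → Edge → Set where
  across₀ : ∀ q → Across (q ⊕ dv D1 , up) (q , down) (q ⊕ dv D1 , D0)
  across₁ : ∀ q → Across (q ⊕ dv D0 , up) (q , down) (q ⊕ dv D0 , D1)
  across₂ : ∀ q → Across (q , up) (q , down) (q ⊕ dv D0 , D2)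

Adjoin : Edge → Triangle → Triangle → Set
Adjoin f Δ Δ' = Δ ≢ Δ' × f ∈ triSides Δ × f ∈ triSides Δ'

across-sideOf : ∀ Δ Δ' d → Δ ≢ Δ' → sideOf Δ d ≡ sideOf Δ' d →
                Across Δ Δ' (sideOf Δ d) ⊎ Across Δ' Δ (sideOf Δ d)
across-sideOf (p , up)   (q , up)   d Δ≢Δ' eq = ⊥-elim (Δ≢Δ' (cong (_, up) (sideOf-injective up d eq)))
across-sideOf (p , down) (q , down) d Δ≢Δ' eq = ⊥-elim (Δ≢Δ' (cong (_, down) (sideOf-injective down d eq)))
across-sideOf (p , up)   (q , down) D0 _ refl = inj₁ (across₀ q)
across-sideOf (p , up)   (q , down) D1 _ refl = inj₁ (across₁ q)
across-sideOf (p , up)   (q , down) D2 _ eq with ⊕-cancelʳ (dv D0) p q (cong proj₁ eq)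
... | refl = inj₁ (across₂ p)
across-sideOf (p , down) (q , up)   D0 _ refl = inj₂ (across₀ p)
across-sideOf (p , down) (q , up)   D1 _ refl = inj₂ (across₁ p)
across-sideOf (p , down) (q , up)   D2 _ eq with ⊕-cancelʳ (dv D0) p q (cong proj₁ eq)
... | refl = inj₂ (across₂ p)

common-side-across : ∀ {Δ Δ' e} → Adjoin e Δ Δ' → Across Δ Δ' e ⊎ Across Δ' Δ e
common-side-across {Δ} {Δ'} {e} (Δ≢Δ' , i , i') =
  subst (λ f → Across Δ Δ' f ⊎ Across Δ' Δ f) (sym eq)
        (across-sideOf Δ Δ' (proj₂ e) Δ≢Δ' (trans (sym eq) (triSides-sideOf Δ' i')))
  where
  eq : e ≡ sideOf Δ (proj₂ e)
  eq = triSides-sideOf Δ i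

-- crossesRay e Δ: the edge e crosses the ray running leftwards (direction -1)
-- from the centre of Δ.  leftOnLine x f, for a horizontal edge f: the point x
-- lies on the line of f, at or to the left of its left end.
crossesRay : Edge → Triangle → Bool
crossesRay (_ , D0) _ = false
crossesRay ((c , d) , D1) ((a , b) , _) = does (b ℤ.≟ d) ∧ does (c ℤ.≤? a)
crossesRay ((c , d) , D2) ((a , b) , up) = does (b ℤ.≟ d) ∧ does (c ℤ.≤? a)
crossesRay ((c , d) , D2) ((a , b) , down) = does (b ℤ.≟ d) ∧ does (c ℤ.≤? a +ℤ 1ℤ)

leftOnLine : Point → Edge → Bool
leftOnLine (c , d) ((a , b) , D0) = does (b ℤ.≟ d) ∧ does (c ℤ.≤? a)
leftOnLine _ (_ , D1) = false
leftOnLine _ (_ , D2) = false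

-- If f is not horizontal, the rays of the two triangles on either side of f
-- differ exactly by f. If f is horizontal, the rays lie in adjacent strips.
-- Then exactly one of them crosses each edge that has an endpoint on f's line
-- at or left of f. These endpoint terms cancel along a closed walk.
crossesRay-across : ∀ {Δ Δ' f} → Across Δ Δ' f → ∀ e →
  crossesRay e Δ xor crossesRay e Δ' ≡ does (e ≟ᵉ f) xor (leftOnLine (src e) f xor leftOnLine (tgt e) f)
crossesRay-across (across₂ (a , b)) ((c , d) , D0) = refl
crossesRay-across (across₂ (a , b)) ((c , d) , D1) = Bool.xor-same (does (b ℤ.≟ d) ∧ does (c ℤ.≤? a))
crossesRay-across (across₂ (a , b)) ((c , d) , D2) rewrite ℤ.+-identityʳ b =
  trans (∧-xor-∧ (does (b ℤ.≟ d)) _ _) (cong₂ (λ x y → (x ∧ y) xor false) (≤-xor-≤1+ c a) (≟-sym b d))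
crossesRay-across (across₁ (a , b)) ((c , d) , D0) = refl
crossesRay-across (across₁ (a , b)) ((c , d) , D1) rewrite ℤ.+-identityʳ b =
  trans (∧-xor-∧ (does (b ℤ.≟ d)) _ _)
        (cong₂ (λ x y → (x ∧ y) xor false)
               (trans (Bool.xor-comm (does (c ℤ.≤? a +ℤ 1ℤ)) (does (c ℤ.≤? a))) (≤-xor-≤1+ c a)) (≟-sym b d))
crossesRay-across (across₁ (a , b)) ((c , d) , D2) rewrite ℤ.+-identityʳ b =
  Bool.xor-same (does (b ℤ.≟ d) ∧ does (c ℤ.≤? a +ℤ 1ℤ))
crossesRay-across (across₀ (a , b)) ((c , d) , D0) rewrite ℤ.+-identityʳ a | ℤ.+-identityʳ d = sym (begin
  (does (c ℤ.≟ a) ∧ does (d ℤ.≟ b +ℤ 1ℤ)) xor ((B ∧ does (c ℤ.≤? a)) xor (B ∧ does (c +ℤ 1ℤ ℤ.≤? a)))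
    ≡⟨ cong₂ _xor_ (cong₂ _∧_ (≟-sym c a) (≟-sym d (b +ℤ 1ℤ))) (∧-xor-∧ B _ _) ⟩
  (does (a ℤ.≟ c) ∧ B) xor (((does (c ℤ.≤? a) xor does (c +ℤ 1ℤ ℤ.≤? a)) ∧ B) xor false)
    ≡⟨ cong (λ x → (does (a ℤ.≟ c) ∧ B) xor x)
            (trans (Bool.xor-identityʳ _) (cong (_∧ B) (≤-xor-1+≤ c a))) ⟩
  (does (a ℤ.≟ c) ∧ B) xor (does (a ℤ.≟ c) ∧ B)
    ≡⟨ Bool.xor-same (does (a ℤ.≟ c) ∧ B) ⟩
  false ∎)
  where
  open ≡-Reasoning
  B : Bool
  B = does (b +ℤ 1ℤ ℤ.≟ d)
crossesRay-across (across₀ (a , b)) ((c , d) , D1)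
  rewrite ℤ.+-identityʳ a | ℤ.+-identityʳ c | ≟-+-cancelʳ b d 1ℤ = refl
crossesRay-across (across₀ (a , b)) ((c , d) , D2)
  rewrite ℤ.+-identityʳ a | ≟-+-cancelʳ b d 1ℤ | -1+≤-≡-≤1+ c a = refl

Joins : Edge → Point → Point → Set
Joins e x y = (src e ≡ x × tgt e ≡ y) ⊎ (src e ≡ y × tgt e ≡ x)

data Walk : Point → Point → Set where
  nil  : ∀ {x} → Walk x x
  cons : ∀ {x y z} (e : Edge) → Joins e x y → Walk y z → Walk x z

edges : ∀ {x y} → Walk x y → List Edge
edges nil          = []
edges (cons e _ w) = e ∷ edges w

_++ʷ_ : ∀ {x y z} → Walk x y → Walk y z → Walk x z
nil          ++ʷ v = v
cons e j w   ++ʷ v = cons e j (w ++ʷ v)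

edges-++ʷ : ∀ {x y z} (w : Walk x y) (v : Walk y z) → edges (w ++ʷ v) ≡ edges w ++ edges v
edges-++ʷ nil          v = refl
edges-++ʷ (cons e _ w) v = cong (e ∷_) (edges-++ʷ w v)

crossings : ∀ {x y} → Walk x y → Triangle → Bool
crossings nil          Δ = false
crossings (cons e _ w) Δ = crossesRay e Δ xor crossings w Δ

traversals : ∀ {x y} → Walk x y → Edge → Bool
traversals nil          f = false
traversals (cons e _ w) f = does (e ≟ᵉ f) xor traversals w f

traversals-++ʷ : ∀ {x y z} (w : Walk x y) (v : Walk y z) f → traversals (w ++ʷ v) f ≡ traversals w f xor traversals v f
traversals-++ʷ nil          v f = refl
traversals-++ʷ (cons e _ w) v f =
  trans (cong (does (e ≟ᵉ f) xor_) (traversals-++ʷ w v f)) (sym (Bool.xor-assoc (does (e ≟ᵉ f)) _ _))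

traversals-absent : ∀ {x y f} (w : Walk x y) → All (_≢ f) (edges w) → traversals w f ≡ false
traversals-absent nil          []          = refl
traversals-absent (cons e _ w) (e≢f ∷ w∌f) =
  cong₂ _xor_ (dec-false (e ≟ᵉ _) e≢f) (traversals-absent w w∌f)

joins-xor : ∀ (g : Point → Bool) {e x y} → Joins e x y → g (src e) xor g (tgt e) ≡ g x xor g y
joins-xor g (inj₁ (refl , refl)) = refl
joins-xor g (inj₂ (refl , refl)) = Bool.xor-comm (g _) (g _)

crossings-across : ∀ {Δ Δ' f} → Across Δ Δ' f → ∀ {x y} (w : Walk x y) →
  crossings w Δ xor crossings w Δ' ≡ traversals w f xor (leftOnLine x f xor leftOnLine y f)
crossings-across {f = f} a {x} nil = sym (Bool.xor-same (leftOnLine x f))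
crossings-across {Δ} {Δ'} {f} a {x} {z} (cons {y = y} e j w) = begin
  (crossesRay e Δ xor crossings w Δ) xor (crossesRay e Δ' xor crossings w Δ')
    ≡⟨ xor-interchange (crossesRay e Δ) (crossings w Δ) (crossesRay e Δ') (crossings w Δ') ⟩
  (crossesRay e Δ xor crossesRay e Δ') xor (crossings w Δ xor crossings w Δ')
    ≡⟨ cong₂ _xor_ (crossesRay-across a e) (crossings-across a w) ⟩
  (does (e ≟ᵉ f) xor (g (src e) xor g (tgt e))) xor (traversals w f xor (g y xor g z))
    ≡⟨ cong (λ b → (does (e ≟ᵉ f) xor b) xor (traversals w f xor (g y xor g z))) (joins-xor g {e} j) ⟩
  (does (e ≟ᵉ f) xor (g x xor g y)) xor (traversals w f xor (g y xor g z))
    ≡⟨ xor-interchange (does (e ≟ᵉ f)) (g x xor g y) (traversals w f) (g y xor g z) ⟩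
  (does (e ≟ᵉ f) xor traversals w f) xor ((g x xor g y) xor (g y xor g z))
    ≡⟨ cong ((does (e ≟ᵉ f) xor traversals w f) xor_) (xor-telescope (g x) (g y) (g z)) ⟩
  (does (e ≟ᵉ f) xor traversals w f) xor (g x xor g z) ∎
  where
  open ≡-Reasoning
  g : Point → Bool
  g p = leftOnLine p f

crossings-across-closed : ∀ {Δ Δ' f} → Across Δ Δ' f ⊎ Across Δ' Δ f → ∀ {x} (w : Walk x x) →
  crossings w Δ xor crossings w Δ' ≡ traversals w f
crossings-across-closed {Δ} {Δ'} {f} (inj₁ a) {x} w = begin
  crossings w Δ xor crossings w Δ'                        ≡⟨ crossings-across a w ⟩
  traversals w f xor (leftOnLine x f xor leftOnLine x f)  ≡⟨ cong (traversals w f xor_) (Bool.xor-same (leftOnLine x f)) ⟩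
  traversals w f xor false                                ≡⟨ Bool.xor-identityʳ (traversals w f) ⟩
  traversals w f                                          ∎
  where open ≡-Reasoning
crossings-across-closed {Δ} {Δ'} (inj₂ a) w =
  trans (Bool.xor-comm (crossings w Δ) (crossings w Δ')) (crossings-across-closed (inj₁ a) w)

crossings-constant : ∀ {T P x} (W : Walk x x) → All (λ e → Covered T (edg e)) (edges W) →
                     ∀ {Δ Δ'} → Path P (ComplAdj T) Δ Δ' → crossings W Δ ≡ crossings W Δ'
crossings-constant W covered (stop _) = refl
crossings-constant W covered (step {Δ} {Δ'} _ (Δ≢Δ' , e , i , i' , uncovered) rest) =
  trans (xor-≡-false⇒≡ (crossings W Δ) (crossings W Δ')
           (trans (crossings-across-closed (common-side-across (Δ≢Δ' , i , i')) W)
                  (traversals-absent W (All.map (λ { c refl → uncovered c }) covered))))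
        (crossings-constant W covered rest)

spanDirs-distinct : ∀ k → let (i , j) = spanDirs k in i ≢ k × j ≢ k × i ≢ j
spanDirs-distinct D0 = (λ ()) , (λ ()) , (λ ())
spanDirs-distinct D1 = (λ ()) , (λ ()) , (λ ())
spanDirs-distinct D2 = (λ ()) , (λ ()) , (λ ())

side-dir≢ : ∀ t {e} → Side t e → proj₂ e ≢ proj₁ t
side-dir≢ (k , p) s with spanDirs k | spanDirs-distinct k
side-dir≢ (k , p) at₀ | i , j | i≢k , j≢k , _ = i≢k
side-dir≢ (k , p) at₁ | i , j | i≢k , j≢k , _ = j≢k
side-dir≢ (k , p) at₂ | i , j | i≢k , j≢k , _ = i≢k
side-dir≢ (k , p) at₃ | i , j | i≢k , j≢k , _ = j≢k

diagonal-dir : ∀ t → proj₂ (diagonal t) ≡ proj₁ t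
diagonal-dir (D0 , p) = refl
diagonal-dir (D1 , p) = refl
diagonal-dir (D2 , p) = refl

diagonal-not-side : ∀ t → ¬ Side t (diagonal t)
diagonal-not-side t s = side-dir≢ t s (diagonal-dir t)

opposite-parallel : ∀ t {e e'} → Opposite t e e' → proj₂ e ≡ proj₂ e'
opposite-parallel (k , p) o with spanDirs k
opposite-parallel (k , p) at₀ | i , j = refl
opposite-parallel (k , p) at₁ | i , j = refl
opposite-parallel (k , p) at₂ | i , j = refl
opposite-parallel (k , p) at₃ | i , j = refl

opposite-side₁ : ∀ t {e e'} → Opposite t e e' → Side t e
opposite-side₁ (k , p) o with spanDirs k
opposite-side₁ (k , p) at₀ | i , j = at₀
opposite-side₁ (k , p) at₁ | i , j = at₂
opposite-side₁ (k , p) at₂ | i , j = at₁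
opposite-side₁ (k , p) at₃ | i , j = at₃

parallel-sides : ∀ t {e e'} → Side t e → Side t e' → proj₂ e ≡ proj₂ e' → e ≡ e' ⊎ Opposite t e e'
parallel-sides (k , p) s s' eq with spanDirs k | spanDirs-distinct k
parallel-sides (k , p) at₀ at₀ _ | i , j | _ = inj₁ refl
parallel-sides (k , p) at₀ at₁ i≡j | i , j | _ , _ , i≢j = ⊥-elim (i≢j i≡j)
parallel-sides (k , p) at₀ at₂ _ | i , j | _ = inj₂ at₀
parallel-sides (k , p) at₀ at₃ i≡j | i , j | _ , _ , i≢j = ⊥-elim (i≢j i≡j)
parallel-sides (k , p) at₁ at₀ j≡i | i , j | _ , _ , i≢j = ⊥-elim (i≢j (sym j≡i))
parallel-sides (k , p) at₁ at₁ _ | i , j | _ = inj₁ refl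
parallel-sides (k , p) at₁ at₂ j≡i | i , j | _ , _ , i≢j = ⊥-elim (i≢j (sym j≡i))
parallel-sides (k , p) at₁ at₃ _ | i , j | _ = inj₂ at₂
parallel-sides (k , p) at₂ at₀ _ | i , j | _ = inj₂ at₁
parallel-sides (k , p) at₂ at₁ i≡j | i , j | _ , _ , i≢j = ⊥-elim (i≢j i≡j)
parallel-sides (k , p) at₂ at₂ _ | i , j | _ = inj₁ refl
parallel-sides (k , p) at₂ at₃ i≡j | i , j | _ , _ , i≢j = ⊥-elim (i≢j i≡j)
parallel-sides (k , p) at₃ at₀ j≡i | i , j | _ , _ , i≢j = ⊥-elim (i≢j (sym j≡i))
parallel-sides (k , p) at₃ at₁ _ | i , j | _ = inj₂ at₃
parallel-sides (k , p) at₃ at₂ j≡i | i , j | _ , _ , i≢j = ⊥-elim (i≢j (sym j≡i))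
parallel-sides (k , p) at₃ at₃ _ | i , j | _ = inj₁ refl

side-src∈vertices : ∀ t {e} → Side t e → src e ∈ vertices t
side-src∈vertices (k , p) s with spanDirs k
side-src∈vertices (k , p) at₀ | i , j = at₀
side-src∈vertices (k , p) at₁ | i , j = at₀
side-src∈vertices (k , p) at₂ | i , j = at₂
side-src∈vertices (k , p) at₃ | i , j = at₁

edge-src∈vertices : ∀ t {e} → e ∈ diagonal t ∷ sides t → src e ∈ vertices t
edge-src∈vertices (D0 , p) at₀ = at₂
edge-src∈vertices (D1 , p) at₀ = at₀
edge-src∈vertices (D2 , p) at₀ = at₁
edge-src∈vertices t (there s) = side-src∈vertices t s

WalkAlong : (Edge → Set) → Point → Point → Set
WalkAlong P x y = Σ (Walk x y) λ w → All P (edges w)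

_▸_ : ∀ {P x y z} → WalkAlong P x y → WalkAlong P y z → WalkAlong P x z
(w , Pw) ▸ (v , Pv) = w ++ʷ v , subst (All _) (sym (edges-++ʷ w v)) (++⁺ Pw Pv)

mapWalkAlong : ∀ {P Q : Edge → Set} {x y} → P ⊆ Q → WalkAlong P x y → WalkAlong Q x y
mapWalkAlong P⊆Q (w , Pw) = w , All.map P⊆Q Pw

walk-from-base : ∀ t {y} → y ∈ vertices t → WalkAlong (Side t) (proj₂ t) y
walk-from-base (k , p) y∈ with spanDirs k
walk-from-base (k , p) at₀ | i , j = nil , []
walk-from-base (k , p) at₁ | i , j = cons (p , i) (inj₁ (refl , refl)) nil , at₀ ∷ []
walk-from-base (k , p) at₂ | i , j = cons (p , j) (inj₁ (refl , refl)) nil , at₁ ∷ []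
walk-from-base (k , p) at₃ | i , j =
  cons (p , i) (inj₁ (refl , refl)) (cons (p ⊕ dv i , j) (inj₁ (refl , refl)) nil) ,
  at₀ ∷ at₃ ∷ []

walk-to-base : ∀ t {x} → x ∈ vertices t → WalkAlong (Side t) x (proj₂ t)
walk-to-base (k , p) x∈ with spanDirs k
walk-to-base (k , p) at₀ | i , j = nil , []
walk-to-base (k , p) at₁ | i , j = cons (p , i) (inj₂ (refl , refl)) nil , at₀ ∷ []
walk-to-base (k , p) at₂ | i , j = cons (p , j) (inj₂ (refl , refl)) nil , at₁ ∷ []
walk-to-base (k , p) at₃ | i , j =
  cons (p ⊕ dv i , j) (inj₂ (refl , refl)) (cons (p , i) (inj₂ (refl , refl)) nil) ,
  at₃ ∷ at₀ ∷ []

walk-on-tile : ∀ t {x y} → x ∈ vertices t → y ∈ vertices t → WalkAlong (Side t) x y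
walk-on-tile t x∈ y∈ = walk-to-base t x∈ ▸ walk-from-base t y∈

data FaceOf (t : Tile) : Face → Set where
  vertex   : ∀ {x} → x ∈ vertices t → FaceOf t (vert x)
  edge     : ∀ {e} → e ∈ diagonal t ∷ sides t → FaceOf t (edg e)
  triangle : ∀ {Δ} → Δ ∈ triangles t → FaceOf t (tri Δ)

faceOf : ∀ {t f} → f ∈ faces t → FaceOf t f
faceOf {t} f∈ with ∈-++⁻ (map vert (vertices t)) f∈
... | inj₁ f∈vs with ∈-map⁻ vert f∈vs
...   | _ , x∈ , refl = vertex x∈
faceOf {t} f∈ | inj₂ f∈es+ts with ∈-++⁻ (map edg (diagonal t ∷ sides t)) f∈es+ts
... | inj₁ f∈es with ∈-map⁻ edg f∈es
...   | _ , e∈ , refl = edge e∈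
faceOf {t} f∈ | inj₂ _ | inj₂ f∈ts with ∈-map⁻ tri f∈ts
... | _ , Δ∈ , refl = triangle Δ∈

edge∈faces : ∀ t {e} → e ∈ diagonal t ∷ sides t → edg e ∈ faces t
edge∈faces t e∈ = ∈-++⁺ʳ (map vert (vertices t)) (∈-++⁺ˡ (∈-map⁺ edg e∈))

side∈faces : ∀ t {e} → Side t e → edg e ∈ faces t
side∈faces t s = edge∈faces t (there s)

triangle∈faces : ∀ t {Δ} → Δ ∈ triangles t → tri Δ ∈ faces t
triangle∈faces t Δ∈ = ∈-++⁺ʳ (map vert (vertices t)) (∈-++⁺ʳ (map edg (diagonal t ∷ sides t)) (∈-map⁺ tri Δ∈))

triangle-side∈edges : ∀ t {Δ e} → Δ ∈ triangles t → e ∈ triSides Δ → e ∈ diagonal t ∷ sides t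
triangle-side∈edges (D0 , p) at₀ at₀ = here (cong (_, D0) (⊕-assoc p (-1ℤ , 0ℤ) (dv D1)))
triangle-side∈edges (D0 , p) at₀ at₁ = there (here (cong (_, D1) (⊕-back-D0 p)))
triangle-side∈edges (D0 , p) at₀ at₂ = there (there (here (cong (_, D2) (⊕-back-D0 p))))
triangle-side∈edges (D0 , p) at₁ at₀ = at₀
triangle-side∈edges (D0 , p) at₁ at₁ = at₃
triangle-side∈edges (D0 , p) at₁ at₂ =
  there (there (there (there (here (cong (_, D2) (⊕-assoc p (dv D2) (dv D0)))))))
triangle-side∈edges (D1 , p) at₀ at₀ = at₁
triangle-side∈edges (D1 , p) at₀ at₁ = at₀
triangle-side∈edges (D1 , p) at₀ at₂ = there at₃
triangle-side∈edges (D1 , p) at₁ at₀ =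
  there (there (there (here (cong (_, D0) (⊕-assoc p (-1ℤ , 0ℤ) (dv D1))))))
triangle-side∈edges (D1 , p) at₁ at₁ = here (cong (_, D1) (⊕-back-D0 p))
triangle-side∈edges (D1 , p) at₁ at₂ = there (there (here (cong (_, D2) (⊕-back-D0 p))))
triangle-side∈edges (D2 , p) at₀ at₀ = at₁
triangle-side∈edges (D2 , p) at₀ at₁ = at₂
triangle-side∈edges (D2 , p) at₀ at₂ = at₀
triangle-side∈edges (D2 , p) at₁ at₀ = at₃
triangle-side∈edges (D2 , p) at₁ at₁ = there at₃
triangle-side∈edges (D2 , p) at₁ at₂ = at₀

side-on-triangle : ∀ t {e} → Side t e → Σ Triangle λ Δ → Δ ∈ triangles t × e ∈ triSides Δ
side-on-triangle (D0 , p) at₀ = _ , at₀ , there (here (cong (_, D1) (sym (⊕-back-D0 p))))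
side-on-triangle (D0 , p) at₁ = _ , at₀ , there (there (here (cong (_, D2) (sym (⊕-back-D0 p)))))
side-on-triangle (D0 , p) at₂ = _ , at₁ , at₁
side-on-triangle (D0 , p) at₃ =
  _ , at₁ , there (there (here (cong (_, D2) (sym (⊕-assoc p (dv D2) (dv D0))))))
side-on-triangle (D1 , p) at₀ = _ , at₀ , at₀
side-on-triangle (D1 , p) at₁ = _ , at₁ , there (there (here (cong (_, D2) (sym (⊕-back-D0 p)))))
side-on-triangle (D1 , p) at₂ =
  _ , at₁ , here (cong (_, D0) (sym (⊕-assoc p (-1ℤ , 0ℤ) (dv D1))))
side-on-triangle (D1 , p) at₃ = _ , at₀ , at₂
side-on-triangle (D2 , p) at₀ = _ , at₀ , at₀
side-on-triangle (D2 , p) at₁ = _ , at₀ , at₁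
side-on-triangle (D2 , p) at₂ = _ , at₁ , at₀
side-on-triangle (D2 , p) at₃ = _ , at₁ , at₁

triangle∈triangles : ∀ {t Δ} → tri Δ ∈ faces t → Δ ∈ triangles t
triangle∈triangles Δ∈ with faceOf Δ∈
... | triangle Δ∈t = Δ∈t

some-side : ∀ Δ → Σ Edge (_∈ triSides Δ)
some-side (p , up) = _ , at₀
some-side (p , down) = _ , at₀

meets⇒common-vertex : ∀ {s t} → Meets s t → Σ Point λ x → x ∈ vertices s × x ∈ vertices t
meets⇒common-vertex {s} {t} (f , f∈s , f∈t) with faceOf f∈s | faceOf f∈t
... | vertex x∈s   | vertex x∈t   = _ , x∈s , x∈t
... | edge e∈s     | edge e∈t     = _ , edge-src∈vertices s e∈s , edge-src∈vertices t e∈t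
... | triangle {Δ} Δ∈s | triangle Δ∈t =
  let _ , e∈Δ = some-side Δ
  in _ , edge-src∈vertices s (triangle-side∈edges s Δ∈s e∈Δ) , edge-src∈vertices t (triangle-side∈edges t Δ∈t e∈Δ)

SideOfOther : List Tile → Tile → Edge → Set
SideOfOther T t e = Σ Tile λ r → r ∈ T × r ≢ t × Side r e

path-walk : ∀ {T t s s' x y} → Path (λ r → r ∈ T × r ≢ t) Meets s s' →
            x ∈ vertices s → y ∈ vertices s' → WalkAlong (SideOfOther T t) x y
path-walk {s = s} (stop (s∈T , s≢t)) x∈ y∈ =
  mapWalkAlong (λ side → s , s∈T , s≢t , side) (walk-on-tile s x∈ y∈)
path-walk {s = s} (step (s∈T , s≢t) meets rest) x∈ y∈ with meets⇒common-vertex meets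
... | z , z∈s , z∈s' =
  mapWalkAlong (λ side → s , s∈T , s≢t , side) (walk-on-tile s x∈ z∈s) ▸ path-walk rest z∈s' y∈

goodMeet-no-triangle : ∀ {s t Δ} → GoodMeet s t → ¬ Common s t (tri Δ)
goodMeet-no-triangle (inj₁ disjoint) c = disjoint _ c
goodMeet-no-triangle (inj₂ (inj₁ (_ , vertexOnly))) c with proj₁ (vertexOnly _) c
... | ()
goodMeet-no-triangle (inj₂ (inj₂ (_ , _ , _ , edgeOnly))) c with edgeOnly _ c
... | inj₁ ()
... | inj₂ (inj₁ ())
... | inj₂ (inj₂ ())

goodMeet-edge-side : ∀ {s t e} → GoodMeet s t → Common s t (edg e) → Side s e × Side t e
goodMeet-edge-side (inj₁ disjoint) c = ⊥-elim (disjoint _ c)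
goodMeet-edge-side (inj₂ (inj₁ (_ , vertexOnly))) c with proj₁ (vertexOnly _) c
... | ()
goodMeet-edge-side (inj₂ (inj₂ (_ , se , te , edgeOnly))) c with edgeOnly _ c
... | inj₁ refl = se , te
... | inj₂ (inj₁ ())
... | inj₂ (inj₂ ())

goodMeet-edge-unique : ∀ {s t e e'} → GoodMeet s t → Common s t (edg e) → Common s t (edg e') → e ≡ e'
goodMeet-edge-unique (inj₁ disjoint) c _ = ⊥-elim (disjoint _ c)
goodMeet-edge-unique (inj₂ (inj₁ (_ , vertexOnly))) c _ with proj₁ (vertexOnly _) c
... | ()
goodMeet-edge-unique (inj₂ (inj₂ (_ , _ , _ , edgeOnly))) c c' with edgeOnly _ c | edgeOnly _ c'
... | inj₁ refl       | inj₁ refl       = refl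
... | inj₂ (inj₁ ()) | _
... | inj₂ (inj₂ ()) | _
... | _              | inj₂ (inj₁ ())
... | _              | inj₂ (inj₂ ())

OnlyNeighbours : List Tile → Tile → Tile → Tile → Set
OnlyNeighbours T t u v = ∀ w → w ∈ T → w ≢ t → Adjacent t w → w ≡ u ⊎ w ≡ v

onlyNeighbours-swap : ∀ {T t u v} → OnlyNeighbours T t u v → OnlyNeighbours T t v u
onlyNeighbours-swap only w w∈ w≢t adj with only w w∈ w≢t adj
... | inj₁ w≡u = inj₂ w≡u
... | inj₂ w≡v = inj₁ w≡v

Unshared : List Tile → Tile → Edge → Set
Unshared T t f = ∀ {r} → r ∈ T → r ≢ t → ¬ Side r f

module _ {T : List Tile} (tr : Tredoku T) where
  open Tredoku tr

  shared-side-unique : ∀ {s s' e e'} → s ∈ T → s' ∈ T → s ≢ s' →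
                       Side s e → Side s' e → Side s e' → Side s' e' → e ≡ e'
  shared-side-unique {s} {s'} s∈ s'∈ s≢s' se s'e se' s'e' =
    goodMeet-edge-unique (P2 s∈ s'∈ s≢s') (side∈faces s se , side∈faces s' s'e) (side∈faces s se' , side∈faces s' s'e')

  diagonal-unshared : ∀ {s r} → s ∈ T → r ∈ T → r ≢ s → ¬ Side r (diagonal s)
  diagonal-unshared {s} {r} s∈ r∈ r≢s r-side =
    diagonal-not-side s (proj₂ (goodMeet-edge-side (P2 r∈ s∈ r≢s) (side∈faces r r-side , edge∈faces s at₀)))

  no-three-tiles-share-side : ∀ {s₁ s₂ s₃ e} → s₁ ∈ T → s₂ ∈ T → s₃ ∈ T → s₁ ≢ s₂ → s₁ ≢ s₃ → s₂ ≢ s₃ →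
                              Side s₁ e → Side s₂ e → Side s₃ e → ⊥
  no-three-tiles-share-side {s₁} {s₂} {s₃} s₁∈ s₂∈ s₃∈ s₁≢s₂ s₁≢s₃ s₂≢s₃ e₁ e₂ e₃
    with side-on-triangle s₁ e₁ | side-on-triangle s₂ e₂ | side-on-triangle s₃ e₃
  ... | Δ₁ , Δ₁∈ , i₁ | Δ₂ , Δ₂∈ , i₂ | Δ₃ , Δ₃∈ , i₃ with no-three-triangles-share-side i₁ i₂ i₃
  ... | inj₁ refl        = goodMeet-no-triangle (P2 s₁∈ s₂∈ s₁≢s₂) (triangle∈faces s₁ Δ₁∈ , triangle∈faces s₂ Δ₂∈)
  ... | inj₂ (inj₁ refl) = goodMeet-no-triangle (P2 s₁∈ s₃∈ s₁≢s₃) (triangle∈faces s₁ Δ₁∈ , triangle∈faces s₃ Δ₃∈)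
  ... | inj₂ (inj₂ refl) = goodMeet-no-triangle (P2 s₂∈ s₃∈ s₂≢s₃) (triangle∈faces s₂ Δ₂∈ , triangle∈faces s₃ Δ₃∈)

  outside-uncovered : ∀ {t f O} → t ∈ T → Side t f → Unshared T t f → ¬ O ∈ triangles t → f ∈ triSides O →
                      ¬ Covered T (tri O)
  outside-uncovered {t} t∈ tf unshared O∉t f∈O (s , s∈ , O∈s) with s ≟ᵗ t
  ... | yes refl = O∉t (triangle∈triangles O∈s)
  ... | no s≢t   = unshared s∈ s≢t (proj₁ (goodMeet-edge-side (P2 s∈ t∈ s≢t)
                     (edge∈faces s (triangle-side∈edges s (triangle∈triangles O∈s) f∈O) , side∈faces t tf)))

-- f₁ and f₂ are the two sides of t other than e₁ and e₂. Crossing f₁, then the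
-- diagonal of t, then f₂ passes through the triangles O₁, A, B, O₂ in turn, so
-- A and B make up t.
record OppositeSidesFrame (t : Tile) (e₁ e₂ : Edge) : Set where
  field
    f₁ f₂       : Edge
    f₁-side     : Side t f₁
    f₂-side     : Side t f₂
    f₁∦e₁       : proj₂ f₁ ≢ proj₂ e₁
    f₂∦e₁       : proj₂ f₂ ≢ proj₂ e₁
    f₁≢f₂       : f₁ ≢ f₂
    f₁≢diagonal : f₁ ≢ diagonal t
    f₁-joins    : Joins f₁ (src e₂) (src e₁)
    O₁ A B O₂   : Triangle
    O₁∣A        : Adjoin f₁ O₁ A
    A∣B         : Adjoin (diagonal t) A B
    B∣O₂        : Adjoin f₂ B O₂
    O₁∉t        : ¬ O₁ ∈ triangles t
    O₂∉t        : ¬ O₂ ∈ triangles t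

frame-D2-D0 : ∀ p → OppositeSidesFrame (D2 , p) (p , D0) (p ⊕ dv D1 , D0)
frame-D2-D0 p = record
  { f₁ = (p , D1) ; f₂ = (p ⊕ dv D0 , D1) ; f₁-side = at₁ ; f₂-side = at₃
  ; f₁∦e₁ = λ () ; f₂∦e₁ = λ () ; f₁≢diagonal = λ ()
  ; f₁≢f₂ = λ e → ⊕-≢-self p (dv D0) (λ ()) (sym (cong proj₁ e))
  ; f₁-joins = inj₂ (refl , refl)
  ; O₁ = (p ⊕ (-1ℤ , 0ℤ) , down) ; A = (p , up) ; B = (p , down) ; O₂ = (p ⊕ dv D0 , up)
  ; O₁∣A = (λ ()) , there (here (cong (_, D1) (sym (⊕-back-D0 p)))) , at₁
  ; A∣B = (λ ()) , at₂ , at₂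
  ; B∣O₂ = (λ ()) , at₁ , at₁
  ; O₁∉t = λ { (here ())
             ; (there (here e)) → ⊕-≢-self p (-1ℤ , 0ℤ) (λ ()) (cong proj₁ e)
             ; (there (there ()))
             }
  ; O₂∉t = λ { (here e) → ⊕-≢-self p (dv D0) (λ ()) (cong proj₁ e)
             ; (there (here ()))
             ; (there (there ()))
             }
  }

frame-D2-D1 : ∀ p → OppositeSidesFrame (D2 , p) (p , D1) (p ⊕ dv D0 , D1)
frame-D2-D1 p = record
  { f₁ = (p , D0) ; f₂ = (p ⊕ dv D1 , D0) ; f₁-side = at₀ ; f₂-side = at₂
  ; f₁∦e₁ = λ () ; f₂∦e₁ = λ () ; f₁≢diagonal = λ ()
  ; f₁≢f₂ = λ e → ⊕-≢-self p (dv D1) (λ ()) (sym (cong proj₁ e))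
  ; f₁-joins = inj₂ (refl , refl)
  ; O₁ = (p ⊕ (0ℤ , -1ℤ) , down) ; A = (p , up) ; B = (p , down) ; O₂ = (p ⊕ dv D1 , up)
  ; O₁∣A = (λ ()) , here (cong (_, D0) (sym (⊕-back-D1 p))) , at₀
  ; A∣B = (λ ()) , at₂ , at₂
  ; B∣O₂ = (λ ()) , at₀ , at₀
  ; O₁∉t = λ { (here ())
             ; (there (here e)) → ⊕-≢-self p (0ℤ , -1ℤ) (λ ()) (cong proj₁ e)
             ; (there (there ()))
             }
  ; O₂∉t = λ { (here e) → ⊕-≢-self p (dv D1) (λ ()) (cong proj₁ e)
             ; (there (here ()))
             ; (there (there ()))
             }
  }

frame-D1-D0 : ∀ p → OppositeSidesFrame (D1 , p) (p , D0) (p ⊕ dv D2 , D0)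
frame-D1-D0 p = record
  { f₁ = (p , D2) ; f₂ = (p ⊕ dv D0 , D2) ; f₁-side = at₁ ; f₂-side = at₃
  ; f₁∦e₁ = λ () ; f₂∦e₁ = λ () ; f₁≢diagonal = λ ()
  ; f₁≢f₂ = λ e → ⊕-≢-self p (dv D0) (λ ()) (sym (cong proj₁ e))
  ; f₁-joins = inj₂ (refl , refl)
  ; O₁ = (p ⊕ (-1ℤ , 0ℤ) , up) ; A = (p ⊕ (-1ℤ , 0ℤ) , down) ; B = (p , up) ; O₂ = (p , down)
  ; O₁∣A = (λ ())
         , there (there (here (cong (_, D2) (sym (⊕-back-D0 p)))))
         , there (there (here (cong (_, D2) (sym (⊕-back-D0 p)))))
  ; A∣B = (λ ()) , there (here (cong (_, D1) (sym (⊕-back-D0 p)))) , at₁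
  ; B∣O₂ = (λ ()) , at₂ , at₂
  ; O₁∉t = λ { (here e) → ⊕-≢-self p (-1ℤ , 0ℤ) (λ ()) (cong proj₁ e)
             ; (there (here ()))
             ; (there (there ()))
             }
  ; O₂∉t = λ { (here ())
             ; (there (here e)) → ⊕-≢-self p (-1ℤ , 0ℤ) (λ ()) (sym (cong proj₁ e))
             ; (there (there ()))
             }
  }

frame-D1-D2 : ∀ p → OppositeSidesFrame (D1 , p) (p , D2) (p ⊕ dv D0 , D2)
frame-D1-D2 p = record
  { f₁ = (p , D0) ; f₂ = (p ⊕ dv D2 , D0) ; f₁-side = at₀ ; f₂-side = at₂
  ; f₁∦e₁ = λ () ; f₂∦e₁ = λ () ; f₁≢diagonal = λ ()
  ; f₁≢f₂ = λ e → ⊕-≢-self p (dv D2) (λ ()) (sym (cong proj₁ e))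
  ; f₁-joins = inj₂ (refl , refl)
  ; O₁ = (p ⊕ (0ℤ , -1ℤ) , down) ; A = (p , up) ; B = (p ⊕ (-1ℤ , 0ℤ) , down) ; O₂ = (p ⊕ dv D2 , up)
  ; O₁∣A = (λ ()) , here (cong (_, D0) (sym (⊕-back-D1 p))) , at₀
  ; A∣B = (λ ()) , at₁ , there (here (cong (_, D1) (sym (⊕-back-D0 p))))
  ; B∣O₂ = (λ ()) , here (cong (_, D0) (sym (⊕-assoc p (-1ℤ , 0ℤ) (dv D1)))) , at₀
  ; O₁∉t = λ { (here ())
             ; (there (here e)) → ⊕-≢ p (0ℤ , -1ℤ) (-1ℤ , 0ℤ) (λ ()) (cong proj₁ e)
             ; (there (there ()))
             }
  ; O₂∉t = λ { (here e) → ⊕-≢-self p (dv D2) (λ ()) (cong proj₁ e)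
             ; (there (here ()))
             ; (there (there ()))
             }
  }

frame-D0-D1 : ∀ p → OppositeSidesFrame (D0 , p) (p , D1) (p ⊕ dv D2 , D1)
frame-D0-D1 p = record
  { f₁ = (p , D2) ; f₂ = (p ⊕ dv D1 , D2) ; f₁-side = at₁ ; f₂-side = at₃
  ; f₁∦e₁ = λ () ; f₂∦e₁ = λ () ; f₁≢diagonal = λ ()
  ; f₁≢f₂ = λ e → ⊕-≢-self p (dv D1) (λ ()) (sym (cong proj₁ e))
  ; f₁-joins = inj₂ (refl , refl)
  ; O₁ = (p ⊕ (-1ℤ , 0ℤ) , up) ; A = (p ⊕ (-1ℤ , 0ℤ) , down) ; B = (p ⊕ dv D2 , up) ; O₂ = (p ⊕ dv D2 , down)
  ; O₁∣A = (λ ())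
         , there (there (here (cong (_, D2) (sym (⊕-back-D0 p)))))
         , there (there (here (cong (_, D2) (sym (⊕-back-D0 p)))))
  ; A∣B = (λ ()) , here (cong (_, D0) (sym (⊕-assoc p (-1ℤ , 0ℤ) (dv D1)))) , at₀
  ; B∣O₂ = (λ ())
         , there (there (here (cong (_, D2) (sym (⊕-assoc p (dv D2) (dv D0))))))
         , there (there (here (cong (_, D2) (sym (⊕-assoc p (dv D2) (dv D0))))))
  ; O₁∉t = λ { (here ())
             ; (there (here e)) → ⊕-≢ p (-1ℤ , 0ℤ) (dv D2) (λ ()) (cong proj₁ e)
             ; (there (there ()))
             }
  ; O₂∉t = λ { (here e) → ⊕-≢ p (dv D2) (-1ℤ , 0ℤ) (λ ()) (cong proj₁ e)
             ; (there (here ()))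
             ; (there (there ()))
             }
  }

frame-D0-D2 : ∀ p → OppositeSidesFrame (D0 , p) (p , D2) (p ⊕ dv D1 , D2)
frame-D0-D2 p = record
  { f₁ = (p , D1) ; f₂ = (p ⊕ dv D2 , D1) ; f₁-side = at₀ ; f₂-side = at₂
  ; f₁∦e₁ = λ () ; f₂∦e₁ = λ () ; f₁≢diagonal = λ ()
  ; f₁≢f₂ = λ e → ⊕-≢-self p (dv D2) (λ ()) (sym (cong proj₁ e))
  ; f₁-joins = inj₂ (refl , refl)
  ; O₁ = (p , up) ; A = (p ⊕ (-1ℤ , 0ℤ) , down) ; B = (p ⊕ dv D2 , up) ; O₂ = ((p ⊕ dv D2) ⊕ (-1ℤ , 0ℤ) , down)
  ; O₁∣A = (λ ()) , at₁ , there (here (cong (_, D1) (sym (⊕-back-D0 p))))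
  ; A∣B = (λ ()) , here (cong (_, D0) (sym (⊕-assoc p (-1ℤ , 0ℤ) (dv D1)))) , at₀
  ; B∣O₂ = (λ ()) , at₁ , there (here (cong (_, D1) (sym (⊕-back-D0 (p ⊕ dv D2)))))
  ; O₁∉t = λ { (here ())
             ; (there (here e)) → ⊕-≢-self p (dv D2) (λ ()) (sym (cong proj₁ e))
             ; (there (there ()))
             }
  ; O₂∉t = λ { (here e) → ⊕-≢ p ((dv D2) ⊕ (-1ℤ , 0ℤ)) (-1ℤ , 0ℤ) (λ ()) (trans (sym (⊕-assoc p (dv D2) (-1ℤ , 0ℤ))) (cong proj₁ e))
             ; (there (here ()))
             ; (there (there ()))
             }
  }

opposite-frame : ∀ t {e e'} → Opposite t e e' → OppositeSidesFrame t e e' ⊎ OppositeSidesFrame t e' e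
opposite-frame (D0 , p) at₀ = inj₁ (frame-D0-D1 p)
opposite-frame (D0 , p) at₁ = inj₂ (frame-D0-D1 p)
opposite-frame (D0 , p) at₂ = inj₁ (frame-D0-D2 p)
opposite-frame (D0 , p) at₃ = inj₂ (frame-D0-D2 p)
opposite-frame (D1 , p) at₀ = inj₁ (frame-D1-D0 p)
opposite-frame (D1 , p) at₁ = inj₂ (frame-D1-D0 p)
opposite-frame (D1 , p) at₂ = inj₁ (frame-D1-D2 p)
opposite-frame (D1 , p) at₃ = inj₂ (frame-D1-D2 p)
opposite-frame (D2 , p) at₀ = inj₁ (frame-D2-D0 p)
opposite-frame (D2 , p) at₁ = inj₂ (frame-D2-D0 p)
opposite-frame (D2 , p) at₂ = inj₁ (frame-D2-D1 p)
opposite-frame (D2 , p) at₃ = inj₂ (frame-D2-D1 p)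

module OppositeNeighbours {T : List Tile} (tr : Tredoku T) {t u v e₁ e₂}
  (t∈ : t ∈ T) (u∈ : u ∈ T) (v∈ : v ∈ T) (u≢t : u ≢ t) (v≢t : v ≢ t) (only : OnlyNeighbours T t u v)
  (F : OppositeSidesFrame t e₁ e₂) (e₁∥e₂ : proj₂ e₁ ≡ proj₂ e₂)
  (te₁ : Side t e₁) (ue₁ : Side u e₁) (te₂ : Side t e₂) (ve₂ : Side v e₂)
  where
  open Tredoku tr
  open OppositeSidesFrame F

  free : ∀ {f} → Side t f → proj₂ f ≢ proj₂ e₁ → Unshared T t f
  free tf f∦e₁ r∈ r≢t rf with only _ r∈ r≢t (_ , tf , rf)
  ... | inj₁ refl = f∦e₁ (cong proj₂ (shared-side-unique tr u∈ t∈ u≢t rf tf ue₁ te₁))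
  ... | inj₂ refl = f∦e₁ (trans (cong proj₂ (shared-side-unique tr v∈ t∈ v≢t rf tf ve₂ te₂)) (sym e₁∥e₂))

  W₀ : WalkAlong (SideOfOther T t) (src e₁) (src e₂)
  W₀ = path-walk (P3 t∈ (u∈ , u≢t) (v∈ , v≢t)) (side-src∈vertices u ue₁) (side-src∈vertices v ve₂)

  W : Walk (src e₁) (src e₁)
  W = proj₁ W₀ ++ʷ cons f₁ f₁-joins nil

  W-covered : All (λ e → Covered T (edg e)) (edges W)
  W-covered = subst (All _) (sym (edges-++ʷ (proj₁ W₀) _))
    (++⁺ (All.map (λ (r , r∈ , _ , re) → r , r∈ , side∈faces r re) (proj₂ W₀)) ((t , t∈ , side∈faces t f₁-side) ∷ []))

  traversals-W : ∀ {f} → Unshared T t f → traversals W f ≡ does (f₁ ≟ᵉ f)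
  traversals-W {f} unshared = begin
    traversals W f
      ≡⟨ traversals-++ʷ (proj₁ W₀) (cons f₁ f₁-joins nil) f ⟩
    traversals (proj₁ W₀) f xor (does (f₁ ≟ᵉ f) xor false)
      ≡⟨ cong₂ _xor_ (traversals-absent (proj₁ W₀) (All.map avoids-f (proj₂ W₀)))
                     (Bool.xor-identityʳ (does (f₁ ≟ᵉ f))) ⟩
    does (f₁ ≟ᵉ f) ∎
    where
    open ≡-Reasoning
    avoids-f : ∀ {e} → SideOfOther T t e → e ≢ f
    avoids-f (_ , r∈ , r≢t , re) refl = unshared r∈ r≢t re

  adjoin-parity : ∀ {f Δ Δ'} → Adjoin f Δ Δ' → crossings W Δ xor crossings W Δ' ≡ traversals W f
  adjoin-parity a = crossings-across-closed (common-side-across a) W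

  O₁≢A : crossings W O₁ xor crossings W A ≡ true
  O₁≢A = trans (adjoin-parity O₁∣A) (trans (traversals-W (free f₁-side f₁∦e₁)) (dec-true (f₁ ≟ᵉ f₁) refl))

  A≡B : crossings W A ≡ crossings W B
  A≡B = xor-≡-false⇒≡ _ _ (trans (adjoin-parity A∣B)
          (trans (traversals-W (diagonal-unshared tr t∈)) (dec-false (f₁ ≟ᵉ diagonal t) f₁≢diagonal)))

  B≡O₂ : crossings W B ≡ crossings W O₂
  B≡O₂ = xor-≡-false⇒≡ _ _ (trans (adjoin-parity B∣O₂)
           (trans (traversals-W (free f₂-side f₂∦e₁)) (dec-false (f₁ ≟ᵉ f₂) f₁≢f₂)))

  O₂≡O₁ : crossings W O₂ ≡ crossings W O₁
  O₂≡O₁ = crossings-constant W W-covered (noHoles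
    (outside-uncovered tr t∈ f₂-side (free f₂-side f₂∦e₁) O₂∉t (proj₂ (proj₂ B∣O₂)))
    (outside-uncovered tr t∈ f₁-side (free f₁-side f₁∦e₁) O₁∉t (proj₁ (proj₂ O₁∣A))))

  impossible : ⊥
  impossible = contradiction (begin
    true                               ≡⟨ O₁≢A ⟨
    crossings W O₁ xor crossings W A   ≡⟨ cong (crossings W O₁ xor_) (trans A≡B (trans B≡O₂ O₂≡O₁)) ⟩
    crossings W O₁ xor crossings W O₁  ≡⟨ Bool.xor-same (crossings W O₁) ⟩
    false                              ∎) λ ()
    where open ≡-Reasoning

parallel-neighbours-impossible : ∀ {T} (tr : Tredoku T) {t u v eu ev} → t ∈ T → u ∈ T → v ∈ T →
                                 u ≢ v → u ≢ t → v ≢ t → OnlyNeighbours T t u v →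
                                 Side t eu → Side u eu → Side t ev → Side v ev → proj₂ eu ≡ proj₂ ev → ⊥
parallel-neighbours-impossible tr {t} t∈ u∈ v∈ u≢v u≢t v≢t only teu ueu tev vev eu∥ev
  with parallel-sides t teu tev eu∥ev
... | inj₁ refl = no-three-tiles-share-side tr t∈ u∈ v∈ (u≢t ∘ sym) (v≢t ∘ sym) u≢v teu ueu vev
... | inj₂ opp with opposite-frame t opp
...   | inj₁ F = OppositeNeighbours.impossible tr t∈ u∈ v∈ u≢t v≢t only F eu∥ev teu ueu tev vev
...   | inj₂ F = OppositeNeighbours.impossible tr t∈ v∈ u∈ v≢t u≢t (onlyNeighbours-swap only) F (sym eu∥ev)
                   tev vev teu ueu

EndsWith : ∀ {m} → Vec Tile (suc (suc m)) → Tile → Tile → Set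
EndsWith {zero}  (a ∷ᵥ b ∷ᵥ []ᵥ) u t = a ≡ u × b ≡ t
EndsWith {suc m} (_ ∷ᵥ ts)     u t = EndsWith ts u t

CanPrepend : ∀ {m} → Vec Tile (suc (suc m)) → Vec Edge (suc m) → Tile → Set
CanPrepend ts es s = ¬ s ∈ᵥ ts × Σ Edge λ e → Side s e × Opposite (lookup ts zero) e (lookup es zero)

canPrepend? : ∀ {m} (ts : Vec Tile (suc (suc m))) es s → Dec (CanPrepend ts es s)
canPrepend? ts es s = ¬? (s ∈ᵥ? ts) ×-dec map′ find (λ (_ , e∈ , opp) → lose e∈ opp)
  (any? (λ e → (e , lookup es zero) ∈ᵉᵉ? oppPairs (lookup ts zero)) (sides s))

module _ {T : List Tile} where

  chain-tail : ∀ {m a e} {ts : Vec Tile (suc (suc m))} {es : Vec Edge (suc m)} →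
               ChainWith T (a ∷ᵥ ts) (e ∷ᵥ es) → ChainWith T ts es
  chain-tail c = record
    { inT      = inT ∘ suc
    ; distinct = λ i j eq → suc-injective (distinct (suc i) (suc j) eq)
    ; shared   = shared ∘ suc
    ; parallel = λ i → trans (parallel (suc i)) (sym (parallel (suc zero)))
    ; opposite = opposite ∘ suc
    }
    where open ChainWith c

  chain-cons : ∀ {m s e} {ts : Vec Tile (suc (suc m))} {es : Vec Edge (suc m)} →
               ChainWith T ts es → s ∈ T → ¬ s ∈ᵥ ts → Side s e → Opposite (lookup ts zero) e (lookup es zero) →
               ChainWith T (s ∷ᵥ ts) (e ∷ᵥ es)
  chain-cons {s = s} {e} {ts} {es} c s∈ s∉ se opp = record
    { inT      = λ { zero → s∈ ; (suc i) → inT i }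
    ; distinct = distinct′
    ; shared   = λ { zero → se , opposite-side₁ (lookup ts zero) opp ; (suc i) → shared i }
    ; parallel = λ { zero → refl ; (suc i) → trans (parallel i) (sym (opposite-parallel (lookup ts zero) opp)) }
    ; opposite = λ { zero → opp ; (suc j) → opposite j }
    }
    where
    open ChainWith c
    lookup≢s : ∀ i → lookup ts i ≢ s
    lookup≢s i eq = s∉ (subst (_∈ᵥ ts) eq (∈-lookup i ts))
    distinct′ : ∀ i j → lookup (s ∷ᵥ ts) i ≡ lookup (s ∷ᵥ ts) j → i ≡ j
    distinct′ zero    zero    _  = refl
    distinct′ zero    (suc j) eq = ⊥-elim (lookup≢s j (sym eq))
    distinct′ (suc i) zero    eq = ⊥-elim (lookup≢s i eq)
    distinct′ (suc i) (suc j) eq = cong suc (distinct i j eq)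

  head-not-in-tail : ∀ {m s} {ts : Vec Tile (suc (suc m))} {es} → ChainWith T (s ∷ᵥ ts) es → ¬ s ∈ᵥ ts
  head-not-in-tail c s∈ts =
    0≢1+n (sym (ChainWith.distinct c (suc (VecAny.index s∈ts)) zero (sym (vec-lookup-index s∈ts))))

  chain-length : ∀ {m} {ts : Vec Tile (suc (suc m))} {es} → ChainWith T ts es → suc (suc m) ≤ length T
  chain-length c = injective⇒≤ {f = Any.index ∘ inT} λ {i} {j} eq →
    distinct i j (trans (lookup-index (inT i)) (trans (cong (List.lookup T) eq) (sym (lookup-index (inT j)))))
    where open ChainWith c

FrontMaximalExtension : ∀ {T m} → Vec Tile (suc (suc m)) → Set
FrontMaximalExtension {T} ts = Σ ℕ λ m′ → Σ (Vec Tile (suc (suc m′))) λ ts′ → Σ (Vec Edge (suc m′)) λ es′ →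
  ChainWith T ts′ es′ × (∀ s → ¬ IsChain T (s ∷ᵥ ts′)) × (∀ {u t} → EndsWith ts u t → EndsWith ts′ u t)

first-two-distinct : ∀ {T m} {ts : Vec Tile (suc (suc m))} {es} → ChainWith T ts es → lookup ts zero ≢ lookup ts (suc zero)
first-two-distinct c = 0≢1+n ∘ ChainWith.distinct c zero (suc zero)

module _ {T : List Tile} (tr : Tredoku T) where
  open Tredoku tr

  prepend-blocked : ∀ {m} {ts : Vec Tile (suc (suc m))} {es} → ChainWith T ts es →
                    (∀ s → s ∈ T → ¬ CanPrepend ts es s) → ∀ s → ¬ IsChain T (s ∷ᵥ ts)
  prepend-blocked {ts = ts} {es} c blocked s (e ∷ᵥ es′ , c′) =
    blocked s (inT zero)
      (head-not-in-tail c′ , e , proj₁ (shared zero) , subst (Opposite (lookup ts zero) e) es′₀≡es₀ (opposite zero))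
    where
    open ChainWith c′
    es′₀≡es₀ : lookup es′ zero ≡ lookup es zero
    es′₀≡es₀ = shared-side-unique tr (ChainWith.inT c zero) (ChainWith.inT c (suc zero)) (first-two-distinct c)
                 (proj₁ (shared (suc zero))) (proj₂ (shared (suc zero)))
                 (proj₁ (ChainWith.shared c zero)) (proj₂ (ChainWith.shared c zero))

  -- A chain has at most length T tiles (chain-length), so the fuel never runs out.
  extend-front : ∀ fuel {m} {ts : Vec Tile (suc (suc m))} {es} → length T ≤ fuel + suc (suc m) →
                 ChainWith T ts es → FrontMaximalExtension {T} ts
  extend-front fuel {m} {ts} {es} bound c with any? (canPrepend? ts es) T
  ... | no none = m , ts , es , c , prepend-blocked c (λ s s∈ can → none (lose s∈ can)) , id
  ... | yes some with find some
  ...   | s , s∈ , s∉ts , e , se , opp = grow fuel bound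
    where
    c′ : ChainWith T (s ∷ᵥ ts) (e ∷ᵥ es)
    c′ = chain-cons c s∈ s∉ts se opp
    grow : ∀ fuel → length T ≤ fuel + suc (suc m) → FrontMaximalExtension {T} ts
    grow zero       bound = contradiction bound (<⇒≱ (chain-length c′))
    grow (suc fuel) bound = extend-front fuel (subst (length T ≤_) (sym (+-suc fuel (suc (suc m)))) bound) c′

ParallelLink : Tile → Tile → Dir → Set
ParallelLink w u d = Σ Edge λ c → Side w c × Side u c × proj₂ c ≡ d

module TwoTileRuns {T : List Tile} (tr : Tredoku T) {t u v eu ev}
  (t∈ : t ∈ T) (u∈ : u ∈ T) (v∈ : v ∈ T) (u≢t : u ≢ t) (v≢t : v ≢ t) (only : OnlyNeighbours T t u v)
  (teu : Side t eu) (ueu : Side u eu) (tev : Side t ev) (vev : Side v ev) (eu∦ev : proj₂ eu ≢ proj₂ ev)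
  where
  open Tredoku tr

  nothing-after-t : ∀ z → ¬ IsChain T (u ∷ᵥ t ∷ᵥ z ∷ᵥ []ᵥ)
  nothing-after-t z (e₁ ∷ᵥ e₂ ∷ᵥ []ᵥ , c) =
    [ (λ z≡u → 0≢1+n (sym (distinct (suc (suc zero)) zero z≡u)))
    , (λ z≡v → eu∦ev (trans (cong proj₂ (sym e₁≡eu)) (trans (sym (parallel (suc zero))) (cong proj₂ (e₂≡ev z≡v)))))
    ]′ (only z (inT (suc (suc zero))) z≢t (e₂ , shared (suc zero)))
    where
    open ChainWith c
    z≢t : z ≢ t
    z≢t = 0≢1+n ∘ sym ∘ suc-injective ∘ distinct (suc (suc zero)) (suc zero)
    e₁≡eu : e₁ ≡ eu
    e₁≡eu = shared-side-unique tr u∈ t∈ u≢t (proj₁ (shared zero)) (proj₂ (shared zero)) ueu teu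
    e₂≡ev : z ≡ v → e₂ ≡ ev
    e₂≡ev refl = shared-side-unique tr v∈ t∈ v≢t (proj₂ (shared (suc zero))) (proj₁ (shared (suc zero))) vev tev

  back-blocked : ∀ {m} (ts : Vec Tile (suc (suc m))) → EndsWith ts u t → ∀ z → ¬ IsChain T (ts ∷ʳ z)
  back-blocked {zero}  (_ ∷ᵥ _ ∷ᵥ []ᵥ) (refl , refl) = nothing-after-t
  back-blocked {suc m} (_ ∷ᵥ ts) ends z (_ ∷ᵥ es , c) = back-blocked ts ends z (es , chain-tail c)

  RunThrough : Set
  RunThrough = Σ Tile λ w → IsRun T (w ∷ᵥ u ∷ᵥ t ∷ᵥ []ᵥ) × ParallelLink w u (proj₂ eu)

  three-tile-run : ∀ {m} (ts : Vec Tile (suc (suc m))) es → ChainWith T ts es → IsRun T ts → EndsWith ts u t →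
                   m ≡ 1 → RunThrough
  three-tile-run (w ∷ᵥ _ ∷ᵥ _ ∷ᵥ []ᵥ) (c ∷ᵥ c′ ∷ᵥ []ᵥ) ch run (refl , refl) refl =
    w , run , c , proj₁ (shared zero) , proj₂ (shared zero) , trans (sym (parallel (suc zero))) (cong proj₂ c′≡eu)
    where
    open ChainWith ch
    c′≡eu : c′ ≡ eu
    c′≡eu = shared-side-unique tr u∈ t∈ u≢t (proj₁ (shared (suc zero))) (proj₂ (shared (suc zero))) ueu teu

  start : ChainWith T (u ∷ᵥ t ∷ᵥ []ᵥ) (eu ∷ᵥ []ᵥ)
  start = record
    { inT      = λ { zero → u∈ ; (suc zero) → t∈ }
    ; distinct = λ { zero zero _ → refl ; zero (suc zero) eq → ⊥-elim (u≢t eq)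
                   ; (suc zero) zero eq → ⊥-elim (u≢t (sym eq)) ; (suc zero) (suc zero) _ → refl }
    ; shared   = λ { zero → ueu , teu }
    ; parallel = λ { zero → refl }
    ; opposite = λ ()
    }

  run-through : RunThrough
  run-through =
    let _ , ts , es , ch , front-blocked , ends = extend-front tr (length T) (m≤m+n (length T) 2) start
        run : IsRun T ts
        run = (es , ch) , front-blocked , back-blocked ts (ends (refl , refl))
    in three-tile-run ts es ch run (ends (refl , refl)) (P45 ts run)

distinct-runs : ∀ {T} (tr : Tredoku T) {t u v d₁ d₂ w₁ w₂} → u ∈ T → v ∈ T → u ≢ v → u ≢ t → v ≢ t →
                d₁ ≢ d₂ → ParallelLink w₁ u d₁ → ParallelLink w₂ v d₂ →
                DistinctRuns (w₁ ∷ᵥ u ∷ᵥ t ∷ᵥ []ᵥ) (w₂ ∷ᵥ v ∷ᵥ t ∷ᵥ []ᵥ)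
distinct-runs tr {t} {u} {v} {w₁ = w₁} {w₂} u∈ v∈ u≢v u≢t v≢t d₁≢d₂
              (c₁ , w₁c₁ , uc₁ , c₁∥d₁) (c₂ , w₂c₂ , vc₂ , c₂∥d₂)
  with u ∈ᵥ? (w₂ ∷ᵥ v ∷ᵥ t ∷ᵥ []ᵥ) | v ∈ᵥ? (w₁ ∷ᵥ u ∷ᵥ t ∷ᵥ []ᵥ)
... | no u∉r₂ | _       = u , inj₁ (VecAny.there (VecAny.here refl) , u∉r₂)
... | yes _   | no v∉r₁ = v , inj₂ (VecAny.there (VecAny.here refl) , v∉r₁)
... | yes (VecAny.there (VecAny.here u≡v))         | yes _ = ⊥-elim (u≢v u≡v)
... | yes (VecAny.there (VecAny.there (VecAny.here u≡t))) | yes _ = ⊥-elim (u≢t u≡t)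
... | yes (VecAny.here _) | yes (VecAny.there (VecAny.here v≡u))         = ⊥-elim (u≢v (sym v≡u))
... | yes (VecAny.here _) | yes (VecAny.there (VecAny.there (VecAny.here v≡t))) = ⊥-elim (v≢t v≡t)
... | yes (VecAny.here refl) | yes (VecAny.here refl) =
  ⊥-elim (d₁≢d₂ (trans (sym c₁∥d₁) (trans (cong proj₂ c₁≡c₂) c₂∥d₂)))
  where
  c₁≡c₂ : c₁ ≡ c₂
  c₁≡c₂ = shared-side-unique tr u∈ v∈ u≢v uc₁ w₁c₁ w₂c₂ vc₂

lemma1 : (T : List Tile) → Tredoku T → (t : Tile) → t ∈ T → TwoTile T t →
         Σ ℕ λ m → Σ (Vec Tile (suc (suc m))) λ r₁ →
         Σ ℕ λ n → Σ (Vec Tile (suc (suc n))) λ r₂ →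
         IsRun T r₁ × IsRun T r₂ × DistinctRuns r₁ r₂ × EndTile t r₁ × EndTile t r₂
lemma1 T tr t t∈ (u , v , u≢v , u∈ , v∈ , u≢t , v≢t , (eu , teu , ueu) , (ev , tev , vev) , only)
  with proj₂ eu ≟ᵈ proj₂ ev
... | yes eu∥ev = ⊥-elim (parallel-neighbours-impossible tr t∈ u∈ v∈ u≢v u≢t v≢t only teu ueu tev vev eu∥ev)
... | no eu∦ev =
  let w₁ , run₁ , link₁ = TwoTileRuns.run-through tr t∈ u∈ v∈ u≢t v≢t only teu ueu tev vev eu∦ev
      w₂ , run₂ , link₂ = TwoTileRuns.run-through tr t∈ v∈ u∈ v≢t u≢t (onlyNeighbours-swap only)
                            tev vev teu ueu (eu∦ev ∘ sym)
  in 1 , _ , 1 , _ , run₁ , run₂ , distinct-runs tr u∈ v∈ u≢v u≢t v≢t eu∦ev link₁ link₂ , inj₂ refl , inj₂ refl
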